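{- In System $\mathsf{F}_\wedge$, if $\Theta,X<:\top\vdash T<:T'$ for $\mathsf{F}_\wedge$-types $T,T'$, then for any types $\Theta,\Theta'\vdash S_-$ and $\Theta,\Theta'\vdash S_+$ we have $\Theta,\Theta'\vdash T[(S_-,S_+)/X]<:T'[(S_-,S_+)/X]$.
   Context: System $\mathsf{F}_\wedge$. Types: $T ::= \top\mid X\mid T\to T\mid\forall X.T\mid T\wedge T$ (up to $\alpha$-conversion). Contexts are finite sequences of assumptions $X<:T$ and $x:T$ with the usual well-formedness judgment. Subtyping $\Theta\vdash S<:T$ is generated by: (Var) $\Theta,X<:T,\Theta'\vdash X<:T$; (Top) $\Theta\vdash T<:\top$; (Refl); (Trans); ($\to$) from $\Theta\vdash S'<:S$, $\Theta\vdash T<:T'$ infer $\Theta\vdash S\to T<:S'\to T'$; ($\forall$) from $\Theta,X<:\top\vdash S<:T$ infer $\Theta\vdash\forall X.S<:\forall X.T$; $S\wedge S'<:S$; $S\wedge S'<:S'$; $T<:S\wedge S'$ from $T<:S$ and $T<:S'$. Mixed substitution $T[(S_-,S_+)/X]$ (bound variables renamed to avoid capture): $X[(S_-,S_+)/X]=S_+$; $Y[(S_-,S_+)/X]=Y$ for $Y\not\equiv X$; $\top[(S_-,S_+)/X]=\top$; $(T\to T')[(S_-,S_+)/X]=T[(S_+,S_-)/X]\to T'[(S_-,S_+)/X]$; $(\forall Y.T)[(S_-,S_+)/X]=\forall Y.T[(S_-,S_+)/X]$; $(T\wedge T')[(S_-,S_+)/X]=T[(S_-,S_+)/X]\wedge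 T'[(S_-,S_+)/X]$. -}

module Defs where

open import Data.Nat using (ℕ; zero; suc)
open import Data.Fin using (Fin; zero; suc)

-- Types of System F∧, intrinsically scoped over n type variables (de Bruijn),
-- so α-conversion and capture-avoiding renaming are built in.
data Ty (n : ℕ) : Set where
  ⊤    : Ty n
  var  : Fin n → Ty n
  _⇒_  : Ty n → Ty n → Ty n
  ∀'   : Ty (suc n) → Ty n
  _∧_  : Ty n → Ty n → Ty n

infixr 5 _⇒_
infixl 6 _∧_

extR : ∀ {n m} → (Fin n → Fin m) → Fin (suc n) → Fin (suc m)
extR ρ zero    = zero
extR ρ (suc i) = suc (ρ i)

rename : ∀ {n m} → (Fin n → Fin m) → Ty n → Ty m
rename ρ ⊤        = ⊤
rename ρ (var i)  = var (ρ i)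
rename ρ (S ⇒ T)  = rename ρ S ⇒ rename ρ T
rename ρ (∀' T)   = ∀' (rename (extR ρ) T)
rename ρ (S ∧ T)  = rename ρ S ∧ rename ρ T

weaken : ∀ {n} → Ty n → Ty (suc n)
weaken = rename suc

-- Contexts: sequences of type-variable bounds X <: T and term assumptions x : T.
-- Indexed by the number of type variables in scope (well-scopedness = well-formedness).
data Ctx : ℕ → Set where
  ∅     : Ctx zero
  _,<:_ : ∀ {n} → Ctx n → Ty n → Ctx (suc n)
  _,∶_  : ∀ {n} → Ctx n → Ty n → Ctx n

data Ext (n : ℕ) : ℕ → Set where
  []    : Ext n n
  _,<:_ : ∀ {m} → Ext n m → Ty m → Ext n (suc m)
  _,∶_  : ∀ {m} → Ext n m → Ty m → Ext n m

_++_ : ∀ {n m} → Ctx n → Ext n m → Ctx m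
Θ ++ []          = Θ
Θ ++ (Θ' ,<: T)  = (Θ ++ Θ') ,<: T
Θ ++ (Θ' ,∶ T)   = (Θ ++ Θ') ,∶ T

embed : ∀ {n m} → Ext n m → Fin n → Fin m
embed []          i = i
embed (Θ' ,<: T)  i = suc (embed Θ' i)
embed (Θ' ,∶ T)   i = embed Θ' i

bound : ∀ {n} → Ctx n → Fin n → Ty n
bound (Θ ,<: T) zero    = weaken T
bound (Θ ,<: T) (suc i) = weaken (bound Θ i)
bound (Θ ,∶ T)  i       = bound Θ i

data _⊢_<:_ {n : ℕ} (Θ : Ctx n) : Ty n → Ty n → Set where
  S-Var   : ∀ i → Θ ⊢ var i <: bound Θ i
  S-Top   : ∀ T → Θ ⊢ T <: ⊤
  S-Refl  : ∀ T → Θ ⊢ T <: T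
  S-Trans : ∀ {S U T} → Θ ⊢ S <: U → Θ ⊢ U <: T → Θ ⊢ S <: T
  S-Arr   : ∀ {S S' T T'} → Θ ⊢ S' <: S → Θ ⊢ T <: T' → Θ ⊢ (S ⇒ T) <: (S' ⇒ T')
  S-All   : ∀ {S T} → (Θ ,<: ⊤) ⊢ S <: T → Θ ⊢ ∀' S <: ∀' T
  S-AndL  : ∀ S S' → Θ ⊢ (S ∧ S') <: S
  S-AndR  : ∀ S S' → Θ ⊢ (S ∧ S') <: S'
  S-AndI  : ∀ {T S S'} → Θ ⊢ T <: S → Θ ⊢ T <: S' → Θ ⊢ T <: (S ∧ S')

-- Simultaneous mixed substitution: ρ₋ is used at negative, ρ₊ at positive positions.
extS : ∀ {n m} → (Fin n → Ty m) → Fin (suc n) → Ty (suc m)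
extS σ zero    = var zero
extS σ (suc i) = weaken (σ i)

msubst : ∀ {n m} → (Fin n → Ty m) → (Fin n → Ty m) → Ty n → Ty m
msubst σ₋ σ₊ ⊤        = ⊤
msubst σ₋ σ₊ (var i)  = σ₊ i
msubst σ₋ σ₊ (S ⇒ T)  = msubst σ₊ σ₋ S ⇒ msubst σ₋ σ₊ T
msubst σ₋ σ₊ (∀' T)   = ∀' (msubst (extS σ₋) (extS σ₊) T)
msubst σ₋ σ₊ (S ∧ T)  = msubst σ₋ σ₊ S ∧ msubst σ₋ σ₊ T

single : ∀ {n m} → Ext n m → Ty m → Fin (suc n) → Ty m
single Θ' S zero    = S
single Θ' S (suc i) = var (embed Θ' i)

_[_,_/X]in_ : ∀ {n m} → Ty (suc n) → Ty m → Ty m → Ext n m → Ty m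
T [ S₋ , S₊ /X]in Θ' = msubst (single Θ' S₋) (single Θ' S₊) T

-- A mixed substitution (σ₋, σ₊) preserves subtyping as soon as every σ₊ i lies below
-- the σ₋,σ₊-image of the bound of i, and every σ₋ i below its σ₊,σ₋-image: induction on
-- the derivation, where the arrow rule swaps the two substitutions and the ∀ rule extends
-- both by a fresh variable bounded by ⊤. For X <: ⊤ this condition holds for arbitrary
-- S₋, S₊, and the remaining variables of Θ are sent to themselves in Θ,Θ'.
module Submission where

open import Data.Nat using (ℕ; suc)
open import Data.Fin using (Fin; zero; suc)
open import Data.Product using (_×_; _,_; proj₁; proj₂; swap)
open import Relation.Binary.PropositionalEquality
open import Defs

private
  variable
    n m k : ℕ

rename-fusion : (ρ : Fin n → Fin m) (ρ' : Fin m → Fin k) (ρ'' : Fin n → Fin k)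
  → (∀ i → ρ' (ρ i) ≡ ρ'' i) → ∀ T → rename ρ' (rename ρ T) ≡ rename ρ'' T
rename-fusion ρ ρ' ρ'' h ⊤       = refl
rename-fusion ρ ρ' ρ'' h (var i) = cong var (h i)
rename-fusion ρ ρ' ρ'' h (S ⇒ T) = cong₂ _⇒_ (rename-fusion ρ ρ' ρ'' h S) (rename-fusion ρ ρ' ρ'' h T)
rename-fusion ρ ρ' ρ'' h (∀' T)  = cong ∀' (rename-fusion (extR ρ) (extR ρ') (extR ρ'') h' T)
  where
    h' : ∀ i → extR ρ' (extR ρ i) ≡ extR ρ'' i
    h' zero    = refl
    h' (suc i) = cong suc (h i)
rename-fusion ρ ρ' ρ'' h (S ∧ T) = cong₂ _∧_ (rename-fusion ρ ρ' ρ'' h S) (rename-fusion ρ ρ' ρ'' h T)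

rename-id : (ρ : Fin n → Fin n) → (∀ i → ρ i ≡ i) → ∀ T → rename ρ T ≡ T
rename-id ρ h ⊤       = refl
rename-id ρ h (var i) = cong var (h i)
rename-id ρ h (S ⇒ T) = cong₂ _⇒_ (rename-id ρ h S) (rename-id ρ h T)
rename-id ρ h (∀' T)  = cong ∀' (rename-id (extR ρ) h' T)
  where
    h' : ∀ i → extR ρ i ≡ i
    h' zero    = refl
    h' (suc i) = cong suc (h i)
rename-id ρ h (S ∧ T) = cong₂ _∧_ (rename-id ρ h S) (rename-id ρ h T)

rename-weaken : (ρ : Fin n → Fin m) (T : Ty n) → rename (extR ρ) (weaken T) ≡ weaken (rename ρ T)
rename-weaken ρ T = begin
  rename (extR ρ) (rename suc T)  ≡⟨ rename-fusion suc (extR ρ) sucρ (λ _ → refl) T ⟩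
  rename sucρ T                   ≡⟨ rename-fusion ρ suc sucρ (λ _ → refl) T ⟨
  rename suc (rename ρ T)         ∎
  where
    open ≡-Reasoning
    sucρ : Fin _ → Fin _
    sucρ i = suc (ρ i)

msubst-rename : (ρ : Fin n → Fin m) (σ₋ σ₊ : Fin m → Ty k) (τ₋ τ₊ : Fin n → Ty k)
  → (∀ i → σ₋ (ρ i) ≡ τ₋ i) → (∀ i → σ₊ (ρ i) ≡ τ₊ i)
  → ∀ T → msubst σ₋ σ₊ (rename ρ T) ≡ msubst τ₋ τ₊ T
msubst-rename ρ σ₋ σ₊ τ₋ τ₊ h₋ h₊ ⊤       = refl
msubst-rename ρ σ₋ σ₊ τ₋ τ₊ h₋ h₊ (var i) = h₊ i
msubst-rename ρ σ₋ σ₊ τ₋ τ₊ h₋ h₊ (S ⇒ T) =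
  cong₂ _⇒_ (msubst-rename ρ σ₊ σ₋ τ₊ τ₋ h₊ h₋ S) (msubst-rename ρ σ₋ σ₊ τ₋ τ₊ h₋ h₊ T)
msubst-rename ρ σ₋ σ₊ τ₋ τ₊ h₋ h₊ (∀' T)  =
  cong ∀' (msubst-rename (extR ρ) (extS σ₋) (extS σ₊) (extS τ₋) (extS τ₊) (ext h₋) (ext h₊) T)
  where
    ext : ∀ {σ τ} → (∀ i → σ (ρ i) ≡ τ i) → ∀ i → extS σ (extR ρ i) ≡ extS τ i
    ext h zero    = refl
    ext h (suc i) = cong weaken (h i)
msubst-rename ρ σ₋ σ₊ τ₋ τ₊ h₋ h₊ (S ∧ T) =
  cong₂ _∧_ (msubst-rename ρ σ₋ σ₊ τ₋ τ₊ h₋ h₊ S) (msubst-rename ρ σ₋ σ₊ τ₋ τ₊ h₋ h₊ T)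

rename-msubst : (ρ : Fin m → Fin k) (σ₋ σ₊ : Fin n → Ty m) (τ₋ τ₊ : Fin n → Ty k)
  → (∀ i → rename ρ (σ₋ i) ≡ τ₋ i) → (∀ i → rename ρ (σ₊ i) ≡ τ₊ i)
  → ∀ T → rename ρ (msubst σ₋ σ₊ T) ≡ msubst τ₋ τ₊ T
rename-msubst ρ σ₋ σ₊ τ₋ τ₊ h₋ h₊ ⊤       = refl
rename-msubst ρ σ₋ σ₊ τ₋ τ₊ h₋ h₊ (var i) = h₊ i
rename-msubst ρ σ₋ σ₊ τ₋ τ₊ h₋ h₊ (S ⇒ T) =
  cong₂ _⇒_ (rename-msubst ρ σ₊ σ₋ τ₊ τ₋ h₊ h₋ S) (rename-msubst ρ σ₋ σ₊ τ₋ τ₊ h₋ h₊ T)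
rename-msubst ρ σ₋ σ₊ τ₋ τ₊ h₋ h₊ (∀' T)  =
  cong ∀' (rename-msubst (extR ρ) (extS σ₋) (extS σ₊) (extS τ₋) (extS τ₊) (ext h₋) (ext h₊) T)
  where
    ext : ∀ {σ τ} → (∀ i → rename ρ (σ i) ≡ τ i) → ∀ i → rename (extR ρ) (extS σ i) ≡ extS τ i
    ext h zero        = refl
    ext {σ} h (suc i) = trans (rename-weaken ρ (σ i)) (cong weaken (h i))
rename-msubst ρ σ₋ σ₊ τ₋ τ₊ h₋ h₊ (S ∧ T) =
  cong₂ _∧_ (rename-msubst ρ σ₋ σ₊ τ₋ τ₊ h₋ h₊ S) (rename-msubst ρ σ₋ σ₊ τ₋ τ₊ h₋ h₊ T)

msubst-var : (ρ : Fin n → Fin m) (σ₋ σ₊ : Fin n → Ty m)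
  → (∀ i → σ₋ i ≡ var (ρ i)) → (∀ i → σ₊ i ≡ var (ρ i))
  → ∀ T → msubst σ₋ σ₊ T ≡ rename ρ T
msubst-var ρ σ₋ σ₊ h₋ h₊ ⊤       = refl
msubst-var ρ σ₋ σ₊ h₋ h₊ (var i) = h₊ i
msubst-var ρ σ₋ σ₊ h₋ h₊ (S ⇒ T) = cong₂ _⇒_ (msubst-var ρ σ₊ σ₋ h₊ h₋ S) (msubst-var ρ σ₋ σ₊ h₋ h₊ T)
msubst-var ρ σ₋ σ₊ h₋ h₊ (∀' T)  = cong ∀' (msubst-var (extR ρ) (extS σ₋) (extS σ₊) (ext h₋) (ext h₊) T)
  where
    ext : ∀ {σ} → (∀ i → σ i ≡ var (ρ i)) → ∀ i → extS σ i ≡ var (extR ρ i)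
    ext h zero    = refl
    ext h (suc i) = cong weaken (h i)
msubst-var ρ σ₋ σ₊ h₋ h₊ (S ∧ T) = cong₂ _∧_ (msubst-var ρ σ₋ σ₊ h₋ h₊ S) (msubst-var ρ σ₋ σ₊ h₋ h₊ T)

weaken-msubst : (σ₋ σ₊ : Fin n → Ty m) (T : Ty n)
  → weaken (msubst σ₋ σ₊ T) ≡ msubst (extS σ₋) (extS σ₊) (weaken T)
weaken-msubst σ₋ σ₊ T =
  trans (rename-msubst suc σ₋ σ₊ _ _ (λ _ → refl) (λ _ → refl) T)
        (sym (msubst-rename suc (extS σ₋) (extS σ₊) _ _ (λ _ → refl) (λ _ → refl) T))

msubst-single-weaken : ∀ (Θ' : Ext n m) S₋ S₊ (T : Ty n)
  → msubst (single Θ' S₋) (single Θ' S₊) (weaken T) ≡ rename (embed Θ') T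
msubst-single-weaken Θ' S₋ S₊ T =
  trans (msubst-rename suc (single Θ' S₋) (single Θ' S₊) _ _ (λ _ → refl) (λ _ → refl) T)
        (msubst-var (embed Θ') _ _ (λ _ → refl) (λ _ → refl) T)

BoundPreserving : Ctx n → Ctx m → (Fin n → Fin m) → Set
BoundPreserving Δ Δ' ρ = ∀ i → bound Δ' (ρ i) ≡ rename ρ (bound Δ i)

suc-boundPreserving : (Δ : Ctx n) (T : Ty n) → BoundPreserving Δ (Δ ,<: T) suc
suc-boundPreserving Δ T i = refl

extR-boundPreserving : ∀ {Δ : Ctx n} {Δ' : Ctx m} {ρ} (T : Ty n)
  → BoundPreserving Δ Δ' ρ → BoundPreserving (Δ ,<: T) (Δ' ,<: rename ρ T) (extR ρ)
extR-boundPreserving {ρ = ρ} T h zero    = sym (rename-weaken ρ T)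
extR-boundPreserving {Δ = Δ} {ρ = ρ} T h (suc i) =
  trans (cong weaken (h i)) (sym (rename-weaken ρ (bound Δ i)))

embed-boundPreserving : (Θ : Ctx n) (Θ' : Ext n m) → BoundPreserving Θ (Θ ++ Θ') (embed Θ')
embed-boundPreserving Θ []         i = sym (rename-id (λ j → j) (λ _ → refl) (bound Θ i))
embed-boundPreserving Θ (Θ' ,<: T) i =
  trans (cong weaken (embed-boundPreserving Θ Θ' i))
        (rename-fusion (embed Θ') suc (λ j → suc (embed Θ' j)) (λ _ → refl) (bound Θ i))
embed-boundPreserving Θ (Θ' ,∶ T)  i = embed-boundPreserving Θ Θ' i

<:-rename : ∀ {Δ : Ctx n} {Δ' : Ctx m} {ρ} → BoundPreserving Δ Δ' ρ
  → ∀ {A B} → Δ ⊢ A <: B → Δ' ⊢ rename ρ A <: rename ρ B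
<:-rename {Δ' = Δ'} {ρ} h (S-Var i) = subst (Δ' ⊢ var (ρ i) <:_) (h i) (S-Var (ρ i))
<:-rename h (S-Top T)      = S-Top _
<:-rename h (S-Refl T)     = S-Refl _
<:-rename h (S-Trans d e)  = S-Trans (<:-rename h d) (<:-rename h e)
<:-rename h (S-Arr d e)    = S-Arr (<:-rename h d) (<:-rename h e)
<:-rename h (S-All d)      = S-All (<:-rename (extR-boundPreserving ⊤ h) d)
<:-rename h (S-AndL S S')  = S-AndL _ _
<:-rename h (S-AndR S S')  = S-AndR _ _
<:-rename h (S-AndI d e)   = S-AndI (<:-rename h d) (<:-rename h e)

<:-weaken : ∀ {Δ : Ctx n} {A B} (T : Ty n) → Δ ⊢ A <: B → (Δ ,<: T) ⊢ weaken A <: weaken B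
<:-weaken {Δ = Δ} T = <:-rename (suc-boundPreserving Δ T)

BelowBounds : Ctx n → Ctx m → (Fin n → Ty m) → (Fin n → Ty m) → Set
BelowBounds Γ Δ σ₋ σ₊ = ∀ i → Δ ⊢ σ₊ i <: msubst σ₋ σ₊ (bound Γ i)

extS-belowBounds : ∀ {Γ : Ctx n} {Δ : Ctx m} {σ₋ σ₊}
  → BelowBounds Γ Δ σ₋ σ₊ → BelowBounds (Γ ,<: ⊤) (Δ ,<: ⊤) (extS σ₋) (extS σ₊)
extS-belowBounds b zero = S-Top _
extS-belowBounds {Γ = Γ} {Δ} {σ₋} {σ₊} b (suc i) =
  subst ((Δ ,<: ⊤) ⊢ weaken (σ₊ i) <:_) (weaken-msubst σ₋ σ₊ (bound Γ i)) (<:-weaken ⊤ (b i))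

<:-msubst : ∀ {Γ : Ctx n} {Δ : Ctx m} {σ₋ σ₊}
  → BelowBounds Γ Δ σ₋ σ₊ × BelowBounds Γ Δ σ₊ σ₋
  → ∀ {A B} → Γ ⊢ A <: B → Δ ⊢ msubst σ₋ σ₊ A <: msubst σ₋ σ₊ B
<:-msubst b (S-Var i)     = proj₁ b i
<:-msubst b (S-Top T)     = S-Top _
<:-msubst b (S-Refl T)    = S-Refl _
<:-msubst b (S-Trans d e) = S-Trans (<:-msubst b d) (<:-msubst b e)
<:-msubst b (S-Arr d e)   = S-Arr (<:-msubst (swap b) d) (<:-msubst b e)
<:-msubst b (S-All d)     = S-All (<:-msubst (extS-belowBounds (proj₁ b) , extS-belowBounds (proj₂ b)) d)
<:-msubst b (S-AndL S S') = S-AndL _ _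
<:-msubst b (S-AndR S S') = S-AndR _ _
<:-msubst b (S-AndI d e)  = S-AndI (<:-msubst b d) (<:-msubst b e)

single-belowBounds : (Θ : Ctx n) (Θ' : Ext n m) (S₋ S₊ : Ty m)
  → BelowBounds (Θ ,<: ⊤) (Θ ++ Θ') (single Θ' S₋) (single Θ' S₊)
single-belowBounds Θ Θ' S₋ S₊ zero    = S-Top _
single-belowBounds Θ Θ' S₋ S₊ (suc i) =
  subst ((Θ ++ Θ') ⊢ var (embed Θ' i) <:_)
        (trans (embed-boundPreserving Θ Θ' i) (sym (msubst-single-weaken Θ' S₋ S₊ (bound Θ i))))
        (S-Var (embed Θ' i))

mainTheorem17 : ∀ {n m} (Θ : Ctx n) (Θ' : Ext n m) (T T' : Ty (suc n)) (S₋ S₊ : Ty m)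
    → (Θ ,<: ⊤) ⊢ T <: T'
    → (Θ ++ Θ') ⊢ (T [ S₋ , S₊ /X]in Θ') <: (T' [ S₋ , S₊ /X]in Θ')
mainTheorem17 Θ Θ' T T' S₋ S₊ =
  <:-msubst (single-belowBounds Θ Θ' S₋ S₊ , single-belowBounds Θ Θ' S₊ S₋)
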